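{- Let $G$ be a graph and let $k \ge 3$ be odd. Suppose $L_1,\dots,L_k$ are distinct maximal cliques in $G$ such that $L_i$ shares exactly two vertices with $L_{i+1}$ for $1 \le i \le k-1$, and $L_k$ shares exactly two vertices with $L_1$. Then $G$ is not JIS.
   Context: All graphs are finite and simple. A clique is a complete subgraph; a maximal clique is a clique not contained in any larger clique. A graph $G$ is called JIS if there exist a positive integer $n$ and an assignment of an $n$-element set $S_v$ to each vertex $v$ of $G$ such that distinct vertices receive distinct sets, and for distinct vertices $v,w$, $v$ and $w$ are adjacent iff $|S_v \cap S_w| = n-1$ (equivalently, $G$ is isomorphic to an induced subgraph of a Johnson graph). -}

module Defs where

open import Data.Nat using (ℕ; suc; _∸_; _<_; _≤_; _%_)
open import Data.Fin using (Fin; toℕ)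
open import Data.Fin.Subset using (Subset; _∈_; _⊆_; _∩_; ∣_∣)
open import Data.Product using (Σ; _×_)
open import Relation.Binary.PropositionalEquality using (_≡_; _≢_)
open import Relation.Nullary using (¬_)
open import Function.Bundles using (_⇔_)

record Graph (N : ℕ) : Set₁ where
  field
    Adj     : Fin N → Fin N → Set
    sym     : ∀ {u v} → Adj u v → Adj v u
    irrefl  : ∀ {v} → ¬ Adj v v
open Graph public

module _ {N : ℕ} (G : Graph N) where

  IsClique : Subset N → Set
  IsClique C = ∀ {u v} → u ∈ C → v ∈ C → u ≢ v → Adj G u v

  IsMaximalClique : Subset N → Set
  IsMaximalClique C = IsClique C × (∀ D → IsClique D → C ⊆ D → D ⊆ C)

  IsJIS : Set
  IsJIS =
    Σ ℕ λ n → Σ ℕ λ M → Σ (Fin N → Subset M) λ S →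
      (1 ≤ n)
      × (∀ v → ∣ S v ∣ ≡ n)
      × (∀ v w → S v ≡ S w → v ≡ w)
      × (∀ v w → v ≢ w → (Adj G v w ⇔ (∣ S v ∩ S w ∣ ≡ n ∸ 1)))

module Submission where

-- Suppose G is JIS via n-sets S_v with n = m + 1, so that v ~ w iff
-- |S_v ∩ S_w| = m.  Call a clique L a *star* if all S_x (x ∈ L) contain a
-- common m-set, and a *top* if all S_x lie in a common (m+2)-set.
--  1. For pairwise adjacent a, b, c, the set S_c either contains
--     T = S_a ∩ S_b or lies in U = S_a ∪ S_b, but not both; and in a clique a
--     vertex of the first kind and a vertex of the second kind cannot
--     coexist.  Hence a clique with three vertices is a star or a top.
--  2. If two distinct maximal cliques share two vertices a, b, then the common
--     m-set (resp. (m+2)-set) is forced to be S_a ∩ S_b (resp. S_a ∪ S_b); so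
--     if both were stars (resp. tops), a vertex of the second clique would be
--     adjacent to all of the first, contradicting maximality.  Thus such
--     cliques have different kinds.
--  3. Colouring each L_i by its kind gives a proper 2-colouring of the cycle
--     L_1, ..., L_k, which is impossible as k is odd.

open import Defs
open import Data.Nat using (ℕ; zero; suc; _+_; _∸_; _≤_; _<_; _%_; s≤s; z≤n; _<?_)
open import Data.Nat.Properties
open import Data.Fin using (Fin; zero; suc; toℕ; fromℕ<)
open import Data.Fin.Properties using (toℕ-fromℕ<; toℕ<n) renaming (_≟_ to _≟ᶠ_)
open import Data.Fin.Subset using (Subset; outside; inside; _∈_; _∉_; _⊆_; _⊈_; _∩_; _∪_; ∣_∣; ⊥; ⁅_⁆)
open import Data.Fin.Subset.Properties
open import Data.Product using (Σ; _×_; _,_; proj₁; proj₂; ∃)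
open import Data.Sum using (_⊎_; inj₁; inj₂)
open import Data.Bool using (Bool; true; false; not)
open import Data.Bool.Properties using (not-involutive; ¬-not)
open import Data.Vec.Base using ([]; _∷_; here; there)
open import Data.Empty using (⊥-elim) renaming (⊥ to Empty)
open import Relation.Nullary using (¬_; yes; no)
open import Relation.Binary.PropositionalEquality
  using (_≡_; _≢_; refl; trans; cong; cong₂; subst; subst₂; module ≡-Reasoning) renaming (sym to ≡-sym)
open import Function.Bundles using (_⇔_; Equivalence)

-- Counting facts for subsets of a finite set

∣p∩q∣+∣p∪q∣ : ∀ {M} (p q : Subset M) → ∣ p ∩ q ∣ + ∣ p ∪ q ∣ ≡ ∣ p ∣ + ∣ q ∣
∣p∩q∣+∣p∪q∣ []            []            = refl
∣p∩q∣+∣p∪q∣ (outside ∷ p) (outside ∷ q) = ∣p∩q∣+∣p∪q∣ p q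
∣p∩q∣+∣p∪q∣ (outside ∷ p) (inside  ∷ q) =
  trans (+-suc _ _) (trans (cong suc (∣p∩q∣+∣p∪q∣ p q)) (≡-sym (+-suc _ _)))
∣p∩q∣+∣p∪q∣ (inside  ∷ p) (outside ∷ q) = trans (+-suc _ _) (cong suc (∣p∩q∣+∣p∪q∣ p q))
∣p∩q∣+∣p∪q∣ (inside  ∷ p) (inside  ∷ q) =
  cong suc (trans (+-suc _ _) (trans (cong suc (∣p∩q∣+∣p∪q∣ p q)) (≡-sym (+-suc _ _))))

⊈⇒witness : ∀ {M} (p q : Subset M) → p ⊈ q → ∃ λ x → x ∈ p × x ∉ q
⊈⇒witness []      []      p⊈q = ⊥-elim (p⊈q (λ ()))
⊈⇒witness (s ∷ p) (t ∷ q) p⊈q with p ⊆? q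
... | no tail⊈ with ⊈⇒witness p q tail⊈
...   | x , x∈p , x∉q = suc x , there x∈p , λ x∈q → x∉q (drop-there x∈q)
⊈⇒witness (outside ∷ p) (t       ∷ q) p⊈q | yes p⊆q = ⊥-elim (p⊈q (out⊆ p⊆q))
⊈⇒witness (inside  ∷ p) (inside  ∷ q) p⊈q | yes p⊆q = ⊥-elim (p⊈q (in⊆in p⊆q))
⊈⇒witness (inside  ∷ p) (outside ∷ q) p⊈q | yes p⊆q = zero , here , λ ()

⊊⇒∣∣< : ∀ {M} {p q : Subset M} → p ⊆ q → q ⊈ p → ∣ p ∣ < ∣ q ∣
⊊⇒∣∣< {p = p} {q} p⊆q q⊈p = p⊂q⇒∣p∣<∣q∣ (p⊆q , ⊈⇒witness q p q⊈p)

⊆-by-size : ∀ {M} {p q : Subset M} → p ⊆ q → ∣ q ∣ ≤ ∣ p ∣ → q ⊆ p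
⊆-by-size {p = p} {q} p⊆q ∣q∣≤∣p∣ with q ⊆? p
... | yes q⊆p = q⊆p
... | no  q⊈p = ⊥-elim (<⇒≱ (⊊⇒∣∣< p⊆q q⊈p) ∣q∣≤∣p∣)

∣q∣<∣p∣⇒p⊈q : ∀ {M} {p q : Subset M} → ∣ q ∣ < ∣ p ∣ → p ⊈ q
∣q∣<∣p∣⇒p⊈q ∣q∣<∣p∣ p⊆q = <⇒≱ ∣q∣<∣p∣ (p⊆q⇒∣p∣≤∣q∣ p⊆q)

two-members : ∀ {M} (p : Subset M) → ∣ p ∣ ≡ 2 →
  Σ (Fin M) λ u → Σ (Fin M) λ v → u ∈ p × v ∈ p × u ≢ v
two-members {M} p ∣p∣≡2
  with ⊈⇒witness p ⊥ (∣q∣<∣p∣⇒p⊈q (subst₂ _<_ (≡-sym (∣⊥∣≡0 M)) (≡-sym ∣p∣≡2) (s≤s z≤n)))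
... | u , u∈p , _
  with ⊈⇒witness p ⁅ u ⁆ (∣q∣<∣p∣⇒p⊈q (subst₂ _<_ (≡-sym (∣⁅x⁆∣≡1 u)) (≡-sym ∣p∣≡2) ≤-refl))
...   | v , v∈p , v∉⁅u⁆ = u , v , u∈p , v∈p , λ u≡v → v∉⁅u⁆ (subst (_∈ ⁅ u ⁆) u≡v (x∈⁅x⁆ u))

⊆-∩ : ∀ {M} {p q r : Subset M} → r ⊆ p → r ⊆ q → r ⊆ p ∩ q
⊆-∩ r⊆p r⊆q x∈r = x∈p∩q⁺ (r⊆p x∈r , r⊆q x∈r)

∪-⊆ : ∀ {M} {p q r : Subset M} → p ⊆ r → q ⊆ r → p ∪ q ⊆ r
∪-⊆ {p = p} {q} p⊆r q⊆r x∈p∪q with x∈p∪q⁻ p q x∈p∪q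
... | inj₁ x∈p = p⊆r x∈p
... | inj₂ x∈q = q⊆r x∈q

sum-split-≤ : ∀ {x y m n} → x + y ≡ m + n → m ≤ x → y ≤ n
sum-split-≤ {x} {y} {m} {n} x+y≡m+n m≤x =
  +-cancelˡ-≤ m y n (subst (m + y ≤_) x+y≡m+n (+-monoˡ-≤ y m≤x))

sum-split-≥ : ∀ {x y m n} → x + y ≡ m + n → y ≤ n → m ≤ x
sum-split-≥ {x} {y} {m} {n} x+y≡m+n y≤n =
  +-cancelʳ-≤ n m x (subst (_≤ x + n) x+y≡m+n (+-monoʳ-≤ x y≤n))

sum-split-< : ∀ {x y m n} → x + y ≡ m + n → x < m → n < y
sum-split-< {y = y} {n = n} x+y≡m+n x<m with n <? y
... | yes n<y = n<y
... | no  n≮y = ⊥-elim (<⇒≱ x<m (sum-split-≥ x+y≡m+n (≮⇒≥ n≮y)))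

-- Maximal cliques in an arbitrary graph

module _ {N : ℕ} (G : Graph N) where

  maximal-⊈ : ∀ {L L′} → IsMaximalClique G L → IsMaximalClique G L′ → L ≢ L′ → L ⊈ L′
  maximal-⊈ (_ , maxL) (cliqueL′ , _) L≢L′ L⊆L′ = L≢L′ (⊆-antisym L⊆L′ (maxL _ cliqueL′ L⊆L′))

  maximal-absorbs : ∀ {L w} → IsMaximalClique G L →
    (∀ {x} → x ∈ L → x ≢ w → Adj G x w) → w ∈ L
  maximal-absorbs {L} {w} (cliqueL , maxL) adj-w =
    maxL (L ∪ ⁅ w ⁆) clique-L+w (p⊆p∪q ⁅ w ⁆) (q⊆p∪q L ⁅ w ⁆ (x∈⁅x⁆ w))
    where
    clique-L+w : IsClique G (L ∪ ⁅ w ⁆)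
    clique-L+w {u} {v} u∈ v∈ u≢v with x∈p∪q⁻ L ⁅ w ⁆ u∈ | x∈p∪q⁻ L ⁅ w ⁆ v∈
    ... | inj₁ u∈L | inj₁ v∈L = cliqueL u∈L v∈L u≢v
    ... | inj₁ u∈L | inj₂ v∈w rewrite x∈⁅y⁆⇒x≡y w v∈w = adj-w u∈L u≢v
    ... | inj₂ u∈w | inj₁ v∈L rewrite x∈⁅y⁆⇒x≡y w u∈w = Graph.sym G (adj-w v∈L (λ v≡w → u≢v (≡-sym v≡w)))
    ... | inj₂ u∈w | inj₂ v∈w = ⊥-elim (u≢v (trans (x∈⁅y⁆⇒x≡y w u∈w) (≡-sym (x∈⁅y⁆⇒x≡y w v∈w))))

  record Overlap (L L′ : Subset N) : Set where
    field
      a b     : Fin N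
      a≢b     : a ≢ b
      a∈L     : a ∈ L
      b∈L     : b ∈ L
      a∈L′    : a ∈ L′
      b∈L′    : b ∈ L′
      w w′    : Fin N
      w∈L     : w ∈ L
      w∉L′    : w ∉ L′
      w′∈L′   : w′ ∈ L′
      w′∉L    : w′ ∉ L

  find-overlap : ∀ {L L′} → IsMaximalClique G L → IsMaximalClique G L′ → L ≢ L′ →
    ∣ L ∩ L′ ∣ ≡ 2 → Overlap L L′
  find-overlap {L} {L′} maximalL maximalL′ L≢L′ ∣L∩L′∣≡2
    with two-members (L ∩ L′) ∣L∩L′∣≡2
       | ⊈⇒witness L L′ (maximal-⊈ maximalL maximalL′ L≢L′)
       | ⊈⇒witness L′ L (maximal-⊈ maximalL′ maximalL (λ L′≡L → L≢L′ (≡-sym L′≡L)))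
  ... | a , b , a∈ , b∈ , a≢b | w , w∈L , w∉L′ | w′ , w′∈L′ , w′∉L = record
    { a = a ; b = b ; a≢b = a≢b
    ; a∈L = proj₁ (x∈p∩q⁻ L L′ a∈) ; a∈L′ = proj₂ (x∈p∩q⁻ L L′ a∈)
    ; b∈L = proj₁ (x∈p∩q⁻ L L′ b∈) ; b∈L′ = proj₂ (x∈p∩q⁻ L L′ b∈)
    ; w = w ; w∈L = w∈L ; w∉L′ = w∉L′
    ; w′ = w′ ; w′∈L′ = w′∈L′ ; w′∉L = w′∉L }

pair-cases : ∀ {N} {L : Subset N} (P : Fin N → Set) (a b : Fin N) → P a → P b →
  (∀ {x} → x ∈ L → x ≢ a → x ≢ b → P x) → ∀ {x} → x ∈ L → P x
pair-cases P a b Pa Pb Pother {x} x∈L with x ≟ᶠ a | x ≟ᶠ b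
... | yes refl | _        = Pa
... | no _     | yes refl = Pb
... | no x≢a   | no x≢b   = Pother x∈L x≢a x≢b

-- The geometry of a JIS representation by (m+1)-sets

module Representation {N M : ℕ} (G : Graph N) (m : ℕ) (S : Fin N → Subset M)
  (∣S∣ : ∀ v → ∣ S v ∣ ≡ suc m)
  (S-injective : ∀ v w → S v ≡ S w → v ≡ w)
  (adj⇔ : ∀ v w → v ≢ w → (Adj G v w ⇔ (∣ S v ∩ S w ∣ ≡ m))) where

  Close : Fin N → Fin N → Set
  Close v w = ∣ S v ∩ S w ∣ ≡ m

  clique⇒close : ∀ {L u v} → IsClique G L → u ∈ L → v ∈ L → u ≢ v → Close u v
  clique⇒close clique u∈L v∈L u≢v = Equivalence.to (adj⇔ _ _ u≢v) (clique u∈L v∈L u≢v)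

  ∣S∩S∣+∣S∪S∣ : ∀ v w → ∣ S v ∩ S w ∣ + ∣ S v ∪ S w ∣ ≡ suc m + suc m
  ∣S∩S∣+∣S∪S∣ v w = trans (∣p∩q∣+∣p∪q∣ (S v) (S w)) (cong₂ _+_ (∣S∣ v) (∣S∣ w))

  ∣S∪S∣ : ∀ {v w} → Close v w → ∣ S v ∪ S w ∣ ≡ suc (suc m)
  ∣S∪S∣ {v} {w} close = +-cancelˡ-≡ m _ _ (begin
    m + ∣ S v ∪ S w ∣             ≡⟨ cong (_+ ∣ S v ∪ S w ∣) (≡-sym close) ⟩
    ∣ S v ∩ S w ∣ + ∣ S v ∪ S w ∣ ≡⟨ ∣S∩S∣+∣S∪S∣ v w ⟩
    suc m + suc m                 ≡⟨ ≡-sym (+-suc m (suc m)) ⟩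
    m + suc (suc m)               ∎)
    where open ≡-Reasoning

  -- Distinct vertices sharing at least m elements are close (injectivity of S).
  overlap-≥⇒close : ∀ {v w} → m ≤ ∣ S v ∩ S w ∣ → v ≢ w → Close v w
  overlap-≥⇒close {v} {w} m≤ v≢w =
    ≤-antisym (≤-pred (≤∧≢⇒< (subst (∣ S v ∩ S w ∣ ≤_) (∣S∣ v) (∣p∩q∣≤∣p∣ (S v) (S w))) not-equal)) m≤
    where
    not-equal : ∣ S v ∩ S w ∣ ≢ suc m
    not-equal ∣S∩S∣≡ = v≢w (S-injective v w (⊆-antisym Sv⊆Sw (⊆-by-size Sv⊆Sw Sw≤Sv)))
      where
      Sv⊆Sw : S v ⊆ S w
      Sv⊆Sw x∈ = proj₂ (x∈p∩q⁻ (S v) (S w)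
        (⊆-by-size (p∩q⊆p (S v) (S w)) (≤-reflexive (trans (∣S∣ v) (≡-sym ∣S∩S∣≡))) x∈))
      Sw≤Sv : ∣ S w ∣ ≤ ∣ S v ∣
      Sw≤Sv = ≤-reflexive (trans (∣S∣ w) (≡-sym (∣S∣ v)))

  union-≤⇒overlap-≥ : ∀ {v w} → ∣ S v ∪ S w ∣ ≤ suc (suc m) → m ≤ ∣ S v ∩ S w ∣
  union-≤⇒overlap-≥ {v} {w} =
    sum-split-≥ (trans (∣S∩S∣+∣S∪S∣ v w) (≡-sym (+-suc m (suc m))))

  absorbs : ∀ {L w} → IsMaximalClique G L → (∀ {x} → x ∈ L → m ≤ ∣ S x ∩ S w ∣) → w ∈ L
  absorbs maximalL overlaps = maximal-absorbs G maximalL λ x∈L x≢w →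
    Equivalence.from (adj⇔ _ _ x≢w) (overlap-≥⇒close (overlaps x∈L) x≢w)

  Star : Fin N → Fin N → Fin N → Set
  Star a b c = S a ∩ S b ⊆ S c

  Top : Fin N → Fin N → Fin N → Set
  Top a b c = S c ⊆ S a ∪ S b

  -- For a triangle a, b, c the traces X = S_a ∩ S_c and Y = S_b ∩ S_c are
  -- m-subsets of the (m+1)-set S_c, so |X ∩ Y| + |X ∪ Y| = 2m.
  module Triangle {a b c} (ab : Close a b) (ac : Close a c) (bc : Close b c) where

    X Y : Subset M
    X = S a ∩ S c
    Y = S b ∩ S c

    balance : ∣ X ∩ Y ∣ + ∣ X ∪ Y ∣ ≡ m + m
    balance = trans (∣p∩q∣+∣p∪q∣ X Y) (cong₂ _+_ ac bc)

    X∩Y⊆core : X ∩ Y ⊆ S a ∩ S b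
    X∩Y⊆core z∈ = let (z∈X , z∈Y) = x∈p∩q⁻ X Y z∈ in
      x∈p∩q⁺ (proj₁ (x∈p∩q⁻ (S a) (S c) z∈X) , proj₁ (x∈p∩q⁻ (S b) (S c) z∈Y))

    X∪Y⊆Sc : X ∪ Y ⊆ S c
    X∪Y⊆Sc = ∪-⊆ (p∩q⊆q (S a) (S c)) (p∩q⊆q (S b) (S c))

    X∪Y⊆hull : X ∪ Y ⊆ S a ∪ S b
    X∪Y⊆hull = ∪-⊆ (λ z∈ → x∈p∪q⁺ (inj₁ (p∩q⊆p (S a) (S c) z∈)))
                   (λ z∈ → x∈p∪q⁺ (inj₂ (p∩q⊆p (S b) (S c) z∈)))

    -- c cannot be both: |X ∩ Y| ≥ m and |X ∪ Y| ≥ m + 1 would exceed 2m.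
    ¬star×top : Star a b c → Top a b c → Empty
    ¬star×top star top = <⇒≱ (subst (_≤ ∣ X ∪ Y ∣) (∣S∣ c) (p⊆q⇒∣p∣≤∣q∣ Sc⊆X∪Y))
                             (sum-split-≤ balance (subst (_≤ ∣ X ∩ Y ∣) ab (p⊆q⇒∣p∣≤∣q∣ core⊆X∩Y)))
      where
      core⊆X∩Y : S a ∩ S b ⊆ X ∩ Y
      core⊆X∩Y z∈ = let (z∈a , z∈b) = x∈p∩q⁻ (S a) (S b) z∈ in
        x∈p∩q⁺ (x∈p∩q⁺ (z∈a , star z∈) , x∈p∩q⁺ (z∈b , star z∈))
      Sc⊆X∪Y : S c ⊆ X ∪ Y
      Sc⊆X∪Y z∈ with x∈p∪q⁻ (S a) (S b) (top z∈)
      ... | inj₁ z∈a = x∈p∪q⁺ (inj₁ (x∈p∩q⁺ (z∈a , z∈)))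
      ... | inj₂ z∈b = x∈p∪q⁺ (inj₂ (x∈p∩q⁺ (z∈b , z∈)))

    -- c is one of the two: if the core escapes S_c then |X ∩ Y| < m, hence
    -- |X ∪ Y| > m, so X ∪ Y is all of S_c.
    star⊎top : Star a b c ⊎ Top a b c
    star⊎top with S a ∩ S b ⊆? S c
    ... | yes star = inj₁ star
    ... | no  core⊈Sc = inj₂ (λ z∈ → X∪Y⊆hull (Sc⊆X∪Y z∈))
      where
      core⊈X∩Y : S a ∩ S b ⊈ X ∩ Y
      core⊈X∩Y core⊆ = core⊈Sc (λ z∈ → p∩q⊆q (S a) (S c) (p∩q⊆p X Y (core⊆ z∈)))
      ∣X∩Y∣<m : ∣ X ∩ Y ∣ < m
      ∣X∩Y∣<m = subst (∣ X ∩ Y ∣ <_) ab (⊊⇒∣∣< X∩Y⊆core core⊈X∩Y)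
      Sc⊆X∪Y : S c ⊆ X ∪ Y
      Sc⊆X∪Y = ⊆-by-size X∪Y⊆Sc (subst (_≤ ∣ X ∪ Y ∣) (≡-sym (∣S∣ c)) (sum-split-< balance ∣X∩Y∣<m))

  -- In a 4-clique a, b, c, d, a star vertex c and a top vertex d cannot coexist:
  -- if S_c escapes the hull it meets the hull only in the core, so S_c ∩ S_d
  -- lies in T ∩ S_d, which is smaller than m unless d is a star vertex too.
  star-top-clash : ∀ {a b c d} → Close a b → Close a c → Close b c →
    Close a d → Close b d → Close c d → Star a b c → Top a b d → Empty
  star-top-clash {a} {b} {c} {d} ab ac bc ad bd cd star-c top-d with S c ⊆? S a ∪ S b
  ... | yes top-c = Triangle.¬star×top ab ac bc star-c top-c
  ... | no  Sc⊈hull with S a ∩ S b ⊆? S d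
  ...   | yes star-d = Triangle.¬star×top ab ad bd star-d top-d
  ...   | no  core⊈Sd = <⇒≱ ∣core∩Sd∣<m (subst (_≤ ∣ core ∩ S d ∣) cd (p⊆q⇒∣p∣≤∣q∣ Sc∩Sd⊆core∩Sd))
    where
    core hull : Subset M
    core = S a ∩ S b
    hull = S a ∪ S b
    core⊆Sc∩hull : core ⊆ S c ∩ hull
    core⊆Sc∩hull = ⊆-∩ star-c (λ z∈ → x∈p∪q⁺ (inj₁ (p∩q⊆p (S a) (S b) z∈)))
    ∣Sc∩hull∣≤∣core∣ : ∣ S c ∩ hull ∣ ≤ ∣ core ∣
    ∣Sc∩hull∣≤∣core∣ = subst (∣ S c ∩ hull ∣ ≤_) (≡-sym ab)
      (≤-pred (subst (∣ S c ∩ hull ∣ <_) (∣S∣ c)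
        (⊊⇒∣∣< (p∩q⊆p (S c) hull) (λ Sc⊆ → Sc⊈hull (λ z∈ → p∩q⊆q (S c) hull (Sc⊆ z∈))))))
    Sc∩Sd⊆core∩Sd : S c ∩ S d ⊆ core ∩ S d
    Sc∩Sd⊆core∩Sd z∈ = let (z∈c , z∈d) = x∈p∩q⁻ (S c) (S d) z∈ in
      x∈p∩q⁺ (⊆-by-size core⊆Sc∩hull ∣Sc∩hull∣≤∣core∣ (x∈p∩q⁺ (z∈c , top-d z∈d)) , z∈d)
    ∣core∩Sd∣<m : ∣ core ∩ S d ∣ < m
    ∣core∩Sd∣<m = subst (∣ core ∩ S d ∣ <_) ab
      (⊊⇒∣∣< (p∩q⊆p core (S d)) (λ core⊆ → core⊈Sd (λ z∈ → p∩q⊆q core (S d) (core⊆ z∈))))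

  IsStar : Subset N → Set
  IsStar L = Σ (Subset M) λ T → ∣ T ∣ ≡ m × (∀ {x} → x ∈ L → T ⊆ S x)

  IsTop : Subset N → Set
  IsTop L = Σ (Subset M) λ U → ∣ U ∣ ≡ suc (suc m) × (∀ {x} → x ∈ L → S x ⊆ U)

  -- A clique with three distinct members is a star or a top: relative to two
  -- members a, b, every other member is a star or a top vertex, and by
  -- star-top-clash all of them are of the same kind as a third member c.
  module _ {L a b} (clique : IsClique G L) (a∈L : a ∈ L) (b∈L : b ∈ L) (a≢b : a ≢ b) where

    private
      ab : Close a b
      ab = clique⇒close clique a∈L b∈L a≢b

      close-to-pair : ∀ {x} → x ∈ L → x ≢ a → x ≢ b → Close a x × Close b x
      close-to-pair x∈L x≢a x≢b = clique⇒close clique a∈L x∈L (λ a≡x → x≢a (≡-sym a≡x))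
                                , clique⇒close clique b∈L x∈L (λ b≡x → x≢b (≡-sym b≡x))

      kind : ∀ {x} → x ∈ L → x ≢ a → x ≢ b → Star a b x ⊎ Top a b x
      kind x∈L x≢a x≢b = let (ax , bx) = close-to-pair x∈L x≢a x≢b in Triangle.star⊎top ab ax bx

      clash : ∀ {x y} → x ∈ L → x ≢ a → x ≢ b → y ∈ L → y ≢ a → y ≢ b →
        Star a b x → Top a b y → Empty
      clash {x} {y} x∈L x≢a x≢b y∈L y≢a y≢b star-x top-y
        with x ≟ᶠ y | close-to-pair x∈L x≢a x≢b | close-to-pair y∈L y≢a y≢b
      ... | yes refl | ax , bx | _       = Triangle.¬star×top ab ax bx star-x top-y
      ... | no  x≢y  | ax , bx | ay , by =
        star-top-clash ab ax bx ay by (clique⇒close clique x∈L y∈L x≢y) star-x top-y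

    classify : ∀ {c} → c ∈ L → c ≢ a → c ≢ b → IsStar L ⊎ IsTop L
    classify c∈L c≢a c≢b with kind c∈L c≢a c≢b
    ... | inj₁ star-c = inj₁ (S a ∩ S b , ab ,
          pair-cases (Star a b) a b (p∩q⊆p (S a) (S b)) (p∩q⊆q (S a) (S b)) all-star)
      where
      all-star : ∀ {x} → x ∈ L → x ≢ a → x ≢ b → Star a b x
      all-star x∈L x≢a x≢b with kind x∈L x≢a x≢b
      ... | inj₁ star-x = star-x
      ... | inj₂ top-x  = ⊥-elim (clash c∈L c≢a c≢b x∈L x≢a x≢b star-c top-x)
    ... | inj₂ top-c = inj₂ (S a ∪ S b , ∣S∪S∣ ab ,
          pair-cases (Top a b) a b (p⊆p∪q (S b)) (q⊆p∪q (S a) (S b)) all-top)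
      where
      all-top : ∀ {x} → x ∈ L → x ≢ a → x ≢ b → Top a b x
      all-top x∈L x≢a x≢b with kind x∈L x≢a x≢b
      ... | inj₁ star-x = ⊥-elim (clash x∈L x≢a x≢b c∈L c≢a c≢b star-x top-c)
      ... | inj₂ top-x  = top-x

  star-core : ∀ {L a b} → IsClique G L → a ∈ L → b ∈ L → a ≢ b →
    (star : IsStar L) → S a ∩ S b ⊆ proj₁ star
  star-core clique a∈L b∈L a≢b (T , ∣T∣≡m , T⊆S) =
    ⊆-by-size (⊆-∩ (T⊆S a∈L) (T⊆S b∈L))
              (≤-reflexive (trans (clique⇒close clique a∈L b∈L a≢b) (≡-sym ∣T∣≡m)))

  top-hull : ∀ {L a b} → IsClique G L → a ∈ L → b ∈ L → a ≢ b →
    (top : IsTop L) → proj₁ top ⊆ S a ∪ S b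
  top-hull clique a∈L b∈L a≢b (U , ∣U∣≡m+2 , S⊆U) =
    ⊆-by-size (∪-⊆ (S⊆U a∈L) (S⊆U b∈L))
              (≤-reflexive (trans ∣U∣≡m+2 (≡-sym (∣S∪S∣ (clique⇒close clique a∈L b∈L a≢b)))))

  isStar : ∀ {L} → IsStar L ⊎ IsTop L → Bool
  isStar (inj₁ _) = true
  isStar (inj₂ _) = false

  -- Two maximal cliques sharing two vertices have different kinds: if both
  -- were stars (tops), their common sets would agree, and the private vertex w′
  -- of L′ would share m elements with every member of L.
  module _ {L L′} (maximalL : IsMaximalClique G L) (shared : Overlap G L L′) where
    open Overlap shared

    ¬star×star : IsStar L → IsStar L′ → Empty
    ¬star×star star (T′ , ∣T′∣≡m , T′⊆S) = w′∉L (absorbs maximalL overlap-w′)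
      where
      T′⊆S-L : ∀ {x} → x ∈ L → T′ ⊆ S x
      T′⊆S-L x∈L z∈T′ = proj₂ (proj₂ star) x∈L
        (star-core (proj₁ maximalL) a∈L b∈L a≢b star (⊆-∩ (T′⊆S a∈L′) (T′⊆S b∈L′) z∈T′))
      overlap-w′ : ∀ {x} → x ∈ L → m ≤ ∣ S x ∩ S w′ ∣
      overlap-w′ x∈L = subst (_≤ _) ∣T′∣≡m (p⊆q⇒∣p∣≤∣q∣ (⊆-∩ (T′⊆S-L x∈L) (T′⊆S w′∈L′)))

    ¬top×top : IsTop L → IsTop L′ → Empty
    ¬top×top top (U′ , ∣U′∣≡m+2 , S⊆U′) = w′∉L (absorbs maximalL overlap-w′)
      where
      S-L⊆U′ : ∀ {x} → x ∈ L → S x ⊆ U′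
      S-L⊆U′ x∈L z∈Sx = ∪-⊆ (S⊆U′ a∈L′) (S⊆U′ b∈L′)
        (top-hull (proj₁ maximalL) a∈L b∈L a≢b top (proj₂ (proj₂ top) x∈L z∈Sx))
      overlap-w′ : ∀ {x} → x ∈ L → m ≤ ∣ S x ∩ S w′ ∣
      overlap-w′ x∈L = union-≤⇒overlap-≥
        (subst (_ ≤_) ∣U′∣≡m+2 (p⊆q⇒∣p∣≤∣q∣ (∪-⊆ (S-L⊆U′ x∈L) (S⊆U′ w′∈L′))))

    kind-of : IsStar L ⊎ IsTop L
    kind-of = classify (proj₁ maximalL) a∈L b∈L a≢b w∈L
      (λ w≡a → w∉L′ (subst (_∈ L′) (≡-sym w≡a) a∈L′))
      (λ w≡b → w∉L′ (subst (_∈ L′) (≡-sym w≡b) b∈L′))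

    kinds-differ : (kind : IsStar L ⊎ IsTop L) (kind′ : IsStar L′ ⊎ IsTop L′) →
      isStar kind ≢ isStar kind′
    kinds-differ (inj₁ star) (inj₁ star′) _ = ¬star×star star star′
    kinds-differ (inj₂ top)  (inj₂ top′)  _ = ¬top×top top top′
    kinds-differ (inj₁ _)    (inj₂ _)     ()
    kinds-differ (inj₂ _)    (inj₁ _)     ()

-- Odd cycles are not 2-colourable

flips : ℕ → Bool → Bool
flips zero    x = x
flips (suc n) x = not (flips n x)

flips-even : ∀ n → suc n % 2 ≡ 1 → ∀ x → flips n x ≡ x
flips-even zero          _   x = refl
flips-even (suc zero)    ()  x
flips-even (suc (suc n)) odd x = trans (not-involutive (flips n x)) (flips-even n odd x)

-- Colours alternating along 0, 1, …, k - 1 return to the colour of 0 after an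
-- even number of steps, so the closing edge from k - 1 to 0 cannot alternate.
odd-cycle-uncolourable : ∀ {k} → k % 2 ≡ 1 → (colour : Fin k → Bool) →
  (∀ i j → toℕ j ≡ toℕ i + 1 → colour i ≢ colour j) →
  (∀ i j → toℕ i ≡ 0 → toℕ j ≡ k ∸ 1 → colour j ≢ colour i) → Empty
odd-cycle-uncolourable {zero}   ()
odd-cycle-uncolourable {suc k′} odd colour step wrap =
  wrap zero last refl (toℕ-fromℕ< k′<k) (trans (colour-at k′ k′<k) (flips-even k′ odd (colour zero)))
  where
  k′<k : k′ < suc k′
  k′<k = n<1+n k′
  last : Fin (suc k′)
  last = fromℕ< k′<k
  colour-at : ∀ n (n<k : n < suc k′) → colour (fromℕ< n<k) ≡ flips n (colour zero)
  colour-at zero    _   = refl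
  colour-at (suc n) n+1<k = trans (¬-not (λ eq → step (fromℕ< n<k) (fromℕ< n+1<k) indices (≡-sym eq)))
                                   (cong not (colour-at n n<k))
    where
    n<k : n < suc k′
    n<k = <-trans (n<1+n n) n+1<k
    indices : toℕ (fromℕ< n+1<k) ≡ toℕ (fromℕ< n<k) + 1
    indices = trans (toℕ-fromℕ< n+1<k) (trans (+-comm 1 n) (cong (_+ 1) (≡-sym (toℕ-fromℕ< n<k))))

cyclic-successor : ∀ {k} (i : Fin k) →
  Σ (Fin k) λ j → toℕ j ≡ toℕ i + 1 ⊎ (toℕ j ≡ 0 × toℕ i ≡ k ∸ 1)
cyclic-successor {suc k′} i with suc (toℕ i) <? suc k′
... | yes i+1<k = fromℕ< i+1<k , inj₁ (trans (toℕ-fromℕ< i+1<k) (+-comm 1 (toℕ i)))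
... | no  i+1≮k = zero , inj₂ (refl , suc-injective (≤-antisym (toℕ<n i) (≮⇒≥ i+1≮k)))

successor-≢ : ∀ {k} {i j : Fin k} → toℕ j ≡ toℕ i + 1 → i ≢ j
successor-≢ {i = i} j≡i+1 refl = 1+n≢n (≡-sym (trans j≡i+1 (+-comm (toℕ i) 1)))

closing-≢ : ∀ {k} {i j : Fin k} → 2 ≤ k → toℕ i ≡ 0 → toℕ j ≡ k ∸ 1 → j ≢ i
closing-≢ (s≤s (s≤s _)) i≡0 j≡k-1 refl with trans (≡-sym i≡0) j≡k-1
... | ()

-- The theorem: colour each L_i by its kind (computed from its overlap with the
-- cyclically next clique); consecutive cliques, including L_k and L_1, get
-- different colours, which is impossible around a cycle of odd length.
proposition3 : ∀ {N : ℕ} (G : Graph N) (k : ℕ) → 3 ≤ k → k % 2 ≡ 1 →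
    (L : Fin k → Subset N) →
    (∀ i → IsMaximalClique G (L i)) →
    (∀ i j → i ≢ j → L i ≢ L j) →
    (∀ i j → toℕ j ≡ toℕ i + 1 → ∣ L i ∩ L j ∣ ≡ 2) →
    (∀ i j → toℕ i ≡ 0 → toℕ j ≡ k ∸ 1 → ∣ L j ∩ L i ∣ ≡ 2) →
    ¬ IsJIS G
proposition3 G k 3≤k odd L maximal distinct next closing (zero , _ , _ , () , _)
proposition3 G k 3≤k odd L maximal distinct next closing (suc m , _ , S , _ , ∣S∣ , S-injective , adj⇔) =
  odd-cycle-uncolourable odd colour
    (λ i j j≡i+1 → kinds-differ (maximal i) (next-overlap i j j≡i+1) _ _)
    (λ i j i≡0 j≡k-1 → kinds-differ (maximal j) (closing-overlap i j i≡0 j≡k-1) _ _)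
  where
  open Representation G m S ∣S∣ S-injective adj⇔

  next-overlap : ∀ i j → toℕ j ≡ toℕ i + 1 → Overlap G (L i) (L j)
  next-overlap i j j≡i+1 =
    find-overlap G (maximal i) (maximal j) (distinct i j (successor-≢ j≡i+1)) (next i j j≡i+1)

  closing-overlap : ∀ i j → toℕ i ≡ 0 → toℕ j ≡ k ∸ 1 → Overlap G (L j) (L i)
  closing-overlap i j i≡0 j≡k-1 = find-overlap G (maximal j) (maximal i)
    (distinct j i (closing-≢ (<⇒≤ 3≤k) i≡0 j≡k-1)) (closing i j i≡0 j≡k-1)

  successor-overlap : ∀ i → Σ (Fin k) λ j → Overlap G (L i) (L j)
  successor-overlap i with cyclic-successor i
  ... | j , inj₁ j≡i+1           = j , next-overlap i j j≡i+1
  ... | j , inj₂ (j≡0 , i≡k-1) = j , closing-overlap j i j≡0 i≡k-1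

  colour : Fin k → Bool
  colour i = isStar (kind-of (maximal i) (proj₂ (successor-overlap i)))
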